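{- Let $T$ be a tree with spread $k$. Then $T$ has a partition into paths each having at least $k/2$ vertices.
   Context: The spread of a tree $T$ is the minimum of $d(x,y)$ over all pairs of distinct leaves $x,y$ of $T$. A partition of $T$ into paths is a collection of vertex-disjoint paths in $T$ covering all vertices. -}

module Defs where

open import Data.Nat using (ℕ; zero; suc; _+_; _*_; _≤_)
open import Data.Fin using (Fin)
open import Data.Bool using (Bool; true; false; T; if_then_else_)
open import Data.List using (List; []; _∷_; map; concat)
open import Data.Nat.ListAction using (sum)
open import Data.List.Base using (length)
open import Data.List.Relation.Unary.AllPairs using (AllPairs)
open import Data.List.Relation.Unary.All using (All)
open import Data.List.Relation.Binary.Permutation.Propositional using (_↭_)
open import Data.Product using (Σ; _×_; ∃; _,_)
open import Data.Empty using (⊥)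
open import Relation.Binary.PropositionalEquality using (_≡_; _≢_)
open import Relation.Nullary using (¬_)
import Data.List as L

record Graph : Set where
  field
    n     : ℕ
    adj   : Fin n → Fin n → Bool
    sym   : ∀ u v → adj u v ≡ adj v u
    irrefl : ∀ v → adj v v ≡ false

open Graph public

Adj : (G : Graph) → Fin (n G) → Fin (n G) → Set
Adj G u v = T (adj G u v)

data Walk (G : Graph) : Fin (n G) → Fin (n G) → ℕ → Set where
  here : ∀ {x} → Walk G x x 0
  step : ∀ {x y z ℓ} → Adj G x y → Walk G y z ℓ → Walk G x z (suc ℓ)

data Chain (G : Graph) : List (Fin (n G)) → Set where
  []  : Chain G []
  [_] : ∀ x → Chain G (x ∷ [])
  _∷_ : ∀ {x y vs} → Adj G x y → Chain G (y ∷ vs) → Chain G (x ∷ y ∷ vs)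

IsPath : (G : Graph) → List (Fin (n G)) → Set
IsPath G vs = (vs ≢ []) × AllPairs _≢_ vs × Chain G vs

last' : ∀ {A : Set} → A → List A → A
last' a [] = a
last' a (b ∷ bs) = last' b bs

IsCycle : (G : Graph) → List (Fin (n G)) → Set
IsCycle G [] = ⊥
IsCycle G (v ∷ vs) = (2 ≤ length vs) × AllPairs _≢_ (v ∷ vs) × Chain G (v ∷ vs)
                     × Adj G (last' v vs) v

Connected : Graph → Set
Connected G = ∀ x y → ∃ λ ℓ → Walk G x y ℓ

Acyclic : Graph → Set
Acyclic G = ∀ vs → ¬ IsCycle G vs

IsTree : Graph → Set
IsTree G = Connected G × Acyclic G

deg : (G : Graph) → Fin (n G) → ℕ
deg G v = sum (map (λ u → if adj G v u then 1 else 0) (L.allFin (n G)))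

IsLeaf : (G : Graph) → Fin (n G) → Set
IsLeaf G v = deg G v ≡ 1

Dist : (G : Graph) → Fin (n G) → Fin (n G) → ℕ → Set
Dist G x y d = Walk G x y d × (∀ ℓ → Walk G x y ℓ → d ≤ ℓ)

HasSpread : Graph → ℕ → Set
HasSpread G k =
  (Σ (Fin (n G)) λ x → Σ (Fin (n G)) λ y →
     IsLeaf G x × IsLeaf G y × x ≢ y × Dist G x y k)
  × (∀ x y d → IsLeaf G x → IsLeaf G y → x ≢ y → Dist G x y d → k ≤ d)

-- A partition of G into paths: a list of paths whose concatenation is a
-- permutation of the vertex list (so vertex-disjoint and covering).
IsPathPartition : (G : Graph) → List (List (Fin (n G))) → Set
IsPathPartition G ps = All (IsPath G) ps × (concat ps ↭ L.allFin (n G))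

-- Root the tree at a leaf r and work upwards from the leaves. For the edge
-- from p down to v, the vertices on v's side are partitioned into paths of
-- at least k/2 vertices plus one open path that starts at v and ends
-- at a leaf. At v, any two open paths arriving from different children
-- join two distinct leaves through v, so together they span a walk of
-- length at least k: the longer one has at least k/2 vertices and is
-- closed off, and the shorter survives. The open path finally reaching r
-- joins the leaf r to another leaf, so it has at least k vertices.
{-# OPTIONS --safe #-}
module Submission where

open import Defs
open import Data.Bool using (Bool; true; false; T; if_then_else_)
open import Data.Empty using (⊥-elim)
open import Data.Fin using (Fin; _≟_)
open import Data.Fin.Properties using (any?; injective⇒≤)
open import Data.List using (List; []; _∷_; _++_; length; concat; lookup; filter; filterᵇ; map; allFin)
open import Data.List.Properties using (concat-++; ++-assoc)
open import Data.List.Membership.Propositional using (_∈_; _∉_; find; lose)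
open import Data.List.Membership.Propositional.Properties
  using (∈-++⁺ˡ; ∈-++⁺ʳ; ∈-++⁻; ∈-∃++; ∈-filter⁺; ∈-filter⁻; ∈-allFin; ∈-lookup)
open import Data.List.Membership.Propositional.Properties.WithK using (unique∧set⇒bag)
open import Data.List.Relation.Binary.BagAndSetEquality using (∼bag⇒↭)
open import Data.List.Relation.Binary.Disjoint.Propositional using (Disjoint)
open import Data.List.Relation.Binary.Permutation.Propositional using (_↭_)
open import Data.List.Relation.Unary.All as All using (All; []; _∷_)
import Data.List.Relation.Unary.All.Properties as Allₚ
open import Data.List.Relation.Unary.AllPairs using ([]; _∷_)
open import Data.List.Relation.Unary.Any using (Any; here; there; toSum; fromSum)
open import Data.List.Relation.Unary.Unique.Propositional using (Unique)
open import Data.List.Relation.Unary.Unique.Propositional.Properties using (++⁺; allFin⁺; filter⁺)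
open import Data.Nat using (ℕ; zero; suc; _+_; _*_; _≤_; _<_; z≤n; s≤s)
open import Data.Nat.Induction using (<-wellFounded)
open import Data.Nat.ListAction using (sum)
open import Data.Nat.Properties
  using ( ≤-refl; ≤-trans; ≤-reflexive; <⇒≤; ≤-pred; ≮⇒≥; ≰⇒≥; n≤1+n; m≤m+n; +-monoˡ-≤
        ; +-comm; +-identityʳ; anyUpTo?; _≤?_)
open import Data.Product using (Σ; Σ-syntax; ∃-syntax; _×_; _,_; proj₁; proj₂)
open import Data.Sum as Sum using (_⊎_; inj₁; inj₂; swap)
open import Function using (_∘_)
open import Function.Bundles using (mk⇔)
open import Induction.WellFounded using (Acc; acc)
open import Relation.Binary.PropositionalEquality as ≡ using (_≡_; _≢_; refl; cong; subst)
open import Relation.Nullary using (¬_; Dec; yes; no; contradiction)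
open import Relation.Unary using (Decidable)
open import Relation.Nullary.Decidable using (map′; decidable-stable; T?; ¬?; _×-dec_)

module _ {A : Set} where

  last'∈ : ∀ (x : A) xs → last' x xs ∈ x ∷ xs
  last'∈ x []       = here refl
  last'∈ x (y ∷ xs) = there (last'∈ y xs)

  concat-∷-++ : ∀ (xs : List A) xss yss → concat (xs ∷ xss ++ yss) ≡ concat (xs ∷ xss) ++ concat yss
  concat-∷-++ xs xss yss = begin
    xs ++ concat (xss ++ yss)         ≡⟨ cong (xs ++_) (concat-++ xss yss) ⟨
    xs ++ (concat xss ++ concat yss)  ≡⟨ ++-assoc xs (concat xss) (concat yss) ⟨
    (xs ++ concat xss) ++ concat yss  ∎
    where open ≡.≡-Reasoning

  sum-indicator≡length-filterᵇ : ∀ (f : A → Bool) xs →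
    sum (map (λ x → if f x then 1 else 0) xs) ≡ length (filterᵇ f xs)
  sum-indicator≡length-filterᵇ f []       = refl
  sum-indicator≡length-filterᵇ f (x ∷ xs) with f x
  ... | true  = cong suc (sum-indicator≡length-filterᵇ f xs)
  ... | false = sum-indicator≡length-filterᵇ f xs

  length≡1⇒only-member : ∀ {xs : List A} → length xs ≡ 1 →
                         ∃[ x ] (x ∈ xs × ∀ {y} → y ∈ xs → y ≡ x)
  length≡1⇒only-member {x ∷ []} _ = x , here refl , λ { (here y≡x) → y≡x ; (there ()) }

  only-member⇒length≡1 : ∀ {xs : List A} {x} → Unique xs → x ∈ xs → (∀ {y} → y ∈ xs → y ≡ x) →
                         length xs ≡ 1
  only-member⇒length≡1 {_ ∷ []}    _           _ _    = refl
  only-member⇒length≡1 {_ ∷ _ ∷ _} (y∉ ∷ _) _ only =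
    contradiction (≡.trans (only (here refl)) (≡.sym (only (there (here refl))))) (All.head y∉)

  Unique-++⁻ˡ : ∀ (xs : List A) {ys} → Unique (xs ++ ys) → Unique xs
  Unique-++⁻ˡ []       _          = []
  Unique-++⁻ˡ (x ∷ xs) (x∉ ∷ xs!) = Allₚ.++⁻ˡ xs x∉ ∷ Unique-++⁻ˡ xs xs!

  Unique-++⇒Disjoint : ∀ (xs : List A) {ys} → Unique (xs ++ ys) → Disjoint xs ys
  Unique-++⇒Disjoint (x ∷ xs) (x∉ ∷ _)   (here refl , v∈ys) = All.lookup (Allₚ.++⁻ʳ xs x∉) v∈ys refl
  Unique-++⇒Disjoint (x ∷ xs) (_  ∷ xs!) (there v∈xs , v∈ys) =
    Unique-++⇒Disjoint xs xs! (v∈xs , v∈ys)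

  Unique⇒lookup-injective : ∀ {xs : List A} → Unique xs →
                            ∀ {i j} → lookup xs i ≡ lookup xs j → i ≡ j
  Unique⇒lookup-injective (_  ∷ _)   {Fin.zero}  {Fin.zero}  _  = refl
  Unique⇒lookup-injective (x∉ ∷ _)   {Fin.zero}  {Fin.suc j} eq =
    contradiction eq (All.lookup x∉ (∈-lookup j))
  Unique⇒lookup-injective (x∉ ∷ _)   {Fin.suc i} {Fin.zero}  eq =
    contradiction (≡.sym eq) (All.lookup x∉ (∈-lookup i))
  Unique⇒lookup-injective (_  ∷ xs!) {Fin.suc i} {Fin.suc j} eq =
    cong Fin.suc (Unique⇒lookup-injective xs! eq)

Unique⇒length≤ : ∀ {m} {xs : List (Fin m)} → Unique xs → length xs ≤ m
Unique⇒length≤ xs! = injective⇒≤ (Unique⇒lookup-injective xs!)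

≤-sum⇒≤-double : ∀ {k m l} → k ≤ m + l → m ≤ l → k ≤ 2 * l
≤-sum⇒≤-double {l = l} k≤m+l m≤l =
  ≤-trans k≤m+l (≤-trans (+-monoˡ-≤ l m≤l) (≤-reflexive (cong (l +_) (≡.sym (+-identityʳ l)))))

Vertex : Graph → Set
Vertex G = Fin (n G)

LeafDistancesAtLeast : Graph → ℕ → Set
LeafDistancesAtLeast G k = ∀ x y d → IsLeaf G x → IsLeaf G y → x ≢ y → Dist G x y d → k ≤ d

module Walks (G : Graph) where

  private variable
    x y z : Vertex G
    xs ys : List (Vertex G)
    k ℓ m : ℕ

  Adj-sym : Adj G x y → Adj G y x
  Adj-sym {x = x} {y = y} = subst T (Graph.sym G x y)

  Adj-irrefl : ¬ Adj G x x
  Adj-irrefl {x = x} = subst T (irrefl G x)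

  Chain-tail : Chain G (x ∷ y ∷ xs) → Chain G (y ∷ xs)
  Chain-tail (_ ∷ c) = c

  Chain-split : Chain G (x ∷ xs ++ y ∷ ys) → Chain G (x ∷ xs) × Adj G (last' x xs) y
  Chain-split {xs = []}     (a ∷ _) = [ _ ] , a
  Chain-split {xs = _ ∷ xs} (a ∷ c) = let c′ , a′ = Chain-split {xs = xs} c in a ∷ c′ , a′

  Chain⇒Walk : Chain G (x ∷ xs) → Walk G x (last' x xs) (length xs)
  Chain⇒Walk [ _ ]   = here
  Chain⇒Walk (a ∷ c) = step a (Chain⇒Walk c)

  _▷_ : Walk G x y ℓ → Adj G y z → Walk G x z (suc ℓ)
  here     ▷ a = step a here
  step b w ▷ a = step b (w ▷ a)

  _++ʷ_ : Walk G x y ℓ → Walk G y z m → Walk G x z (ℓ + m)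
  here     ++ʷ w′ = w′
  step a w ++ʷ w′ = step a (w ++ʷ w′)

  reverseʷ : Walk G x y ℓ → Walk G y x ℓ
  reverseʷ here       = here
  reverseʷ (step a w) = reverseʷ w ▷ Adj-sym a

  walk? : ∀ ℓ x y → Dec (Walk G x y ℓ)
  walk? zero x y with x ≟ y
  ... | yes refl = yes here
  ... | no  x≢y  = no λ { here → x≢y refl }
  walk? (suc ℓ) x y =
    map′ (λ (_ , a , w) → step a w) (λ { (step a w) → _ , a , w })
         (any? λ z → T? (adj G x z) ×-dec walk? ℓ z y)

  shortest-walk : Walk G x y ℓ → ∃[ d ] (Dist G x y d × d ≤ ℓ)
  shortest-walk {x = x} {y = y} {ℓ = ℓ} = go ℓ (<-wellFounded ℓ)
    where
    go : ∀ ℓ → Acc _<_ ℓ → Walk G x y ℓ → ∃[ d ] (Dist G x y d × d ≤ ℓ)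
    go ℓ (acc shorter) w with anyUpTo? (λ m → walk? m x y) ℓ
    ... | yes (m , m<ℓ , w′) =
      let d , dist , d≤m = go m (shorter m<ℓ) w′ in d , dist , ≤-trans d≤m (<⇒≤ m<ℓ)
    ... | no ∄shorter =
      ℓ , (w , λ m w′ → ≮⇒≥ λ m<ℓ → ∄shorter (m , m<ℓ , w′)) , ≤-refl

  spread≤walk : LeafDistancesAtLeast G k → IsLeaf G x → IsLeaf G y → x ≢ y →
                Walk G x y ℓ → k ≤ ℓ
  spread≤walk spread x-leaf y-leaf x≢y w =
    let d , dist , d≤ℓ = shortest-walk w in ≤-trans (spread _ _ d x-leaf y-leaf x≢y dist) d≤ℓ

module Leaves (G : Graph) where

  private variable
    u v : Vertex G

  neighbours : Vertex G → List (Vertex G)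
  neighbours v = filterᵇ (adj G v) (allFin (n G))

  ∈-neighbours⁺ : Adj G v u → u ∈ neighbours v
  ∈-neighbours⁺ {v = v} = ∈-filter⁺ (T? ∘ adj G v) (∈-allFin _)

  ∈-neighbours⁻ : u ∈ neighbours v → Adj G v u
  ∈-neighbours⁻ {v = v} = proj₂ ∘ ∈-filter⁻ (T? ∘ adj G v) {xs = allFin (n G)}

  deg≡length-neighbours : ∀ v → deg G v ≡ length (neighbours v)
  deg≡length-neighbours v = sum-indicator≡length-filterᵇ (adj G v) (allFin (n G))

  leaf⇒only-neighbour : IsLeaf G v → ∃[ u ] (Adj G v u × ∀ {w} → Adj G v w → w ≡ u)
  leaf⇒only-neighbour {v = v} leaf =
    let u , u∈ , only = length≡1⇒only-member (≡.trans (≡.sym (deg≡length-neighbours v)) leaf)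
    in u , ∈-neighbours⁻ u∈ , only ∘ ∈-neighbours⁺

  only-neighbour⇒leaf : Adj G v u → (∀ {w} → Adj G v w → w ≡ u) → IsLeaf G v
  only-neighbour⇒leaf {v = v} a only = ≡.trans (deg≡length-neighbours v)
    (only-member⇒length≡1 (filter⁺ (T? ∘ adj G v) (allFin⁺ (n G)))
                          (∈-neighbours⁺ a) (only ∘ ∈-neighbours⁻))

module Branches (G : Graph) where

  open Walks G using (Adj-sym; Adj-irrefl; Chain-split)

  private variable
    c d p u v w x y z : Vertex G
    xs pre post : List (Vertex G)
    ℓ : ℕ

  -- Branch p v w: w is reached from v by a non-backtracking walk whose first
  -- step avoids p. When p and v are adjacent in a tree, these w form the
  -- component of T - pv containing v.
  data Branch (p v : Vertex G) : Vertex G → Set where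
    self : Branch p v v
    down : Adj G v c → c ≢ p → Branch v c w → Branch p v w

  steps : Branch p v w → List (Vertex G)
  steps self                 = []
  steps (down {c = c} _ _ b) = c ∷ steps b

  Branch-end∈ : (b : Branch p v w) → w ∈ v ∷ steps b
  Branch-end∈ self         = here refl
  Branch-end∈ (down _ _ b) = there (Branch-end∈ b)

  Branch-step : Branch p v z → Adj G z u → Branch p v u ⊎ u ≡ p
  Branch-step {p = p} {u = u} self a with u ≟ p
  ... | yes u≡p = inj₂ u≡p
  ... | no  u≢p = inj₁ (down a u≢p self)
  Branch-step (down a c≢p b) a′ with Branch-step b a′
  ... | inj₁ b′   = inj₁ (down a c≢p b′)
  ... | inj₂ refl = inj₁ self

  Branch-covers-all : Connected G → (∀ {u} → Adj G p u → u ≡ v) → ∀ w → w ≡ p ⊎ Branch p v w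
  Branch-covers-all {p = p} {v = v} connected only w = extend (proj₂ (connected p w)) (inj₁ refl)
    where
    extend : Walk G x y ℓ → x ≡ p ⊎ Branch p v x → y ≡ p ⊎ Branch p v y
    extend here         s           = s
    extend (step a wlk) (inj₁ refl) = extend wlk (inj₂ (subst (Branch p v) (≡.sym (only a)) self))
    extend (step a wlk) (inj₂ b)    = extend wlk (swap (Branch-step b a))

  Child : Vertex G → Vertex G → Vertex G → Set
  Child p v c = Adj G v c × c ≢ p

  Below : Vertex G → Vertex G → Vertex G → Set
  Below p v w = ∃[ c ] (Child p v c × Branch v c w)

  Child? : ∀ p v → Decidable (Child p v)
  Child? p v c = T? (adj G v c) ×-dec ¬? (c ≟ p)

  children : Vertex G → Vertex G → List (Vertex G)
  children p v = filter (Child? p v) (allFin (n G))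

  children-unique : Unique (children p v)
  children-unique {p = p} {v = v} = filter⁺ (Child? p v) (allFin⁺ (n G))

  ∈-children⁺ : Child p v c → c ∈ children p v
  ∈-children⁺ {p = p} {v = v} = ∈-filter⁺ (Child? p v) (∈-allFin _)

  ∈-children⁻ : c ∈ children p v → Child p v c
  ∈-children⁻ {p = p} {v = v} = proj₂ ∘ ∈-filter⁻ (Child? p v) {xs = allFin (n G)}

  data NonBacktracking : List (Vertex G) → Set where
    [_]  : ∀ x → NonBacktracking (x ∷ [])
    edge : Adj G x y → NonBacktracking (x ∷ y ∷ [])
    turn : Adj G x y → x ≢ z → NonBacktracking (y ∷ z ∷ xs) → NonBacktracking (x ∷ y ∷ z ∷ xs)

  NonBacktracking⇒Chain : NonBacktracking xs → Chain G xs
  NonBacktracking⇒Chain [ x ]            = [ x ]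
  NonBacktracking⇒Chain (edge {y = y} a) = a ∷ [ y ]
  NonBacktracking⇒Chain (turn a _ nb)    = a ∷ NonBacktracking⇒Chain nb

  Branch-nonBacktracking : Adj G p v → (b : Branch p v w) → NonBacktracking (p ∷ v ∷ steps b)
  Branch-nonBacktracking a self             = edge a
  Branch-nonBacktracking a (down a′ c≢p b) = turn a (c≢p ∘ ≡.sym) (Branch-nonBacktracking a′ b)

  reverse-onto : Branch p v w → List (Vertex G) → List (Vertex G)
  reverse-onto {v = v} self         ys = v ∷ ys
  reverse-onto {v = v} (down _ _ b) ys = reverse-onto b (v ∷ ys)

  reverse-onto-nonBacktracking : (b : Branch p v w) → NonBacktracking (v ∷ p ∷ xs) →
                                 NonBacktracking (reverse-onto b (p ∷ xs))
  reverse-onto-nonBacktracking self           nb = nb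
  reverse-onto-nonBacktracking (down a c≢p b) nb = reverse-onto-nonBacktracking b (turn (Adj-sym a) c≢p nb)

  reverse-onto-repeats : (b : Branch p v w) → w ∈ xs → ¬ Unique (reverse-onto b xs)
  reverse-onto-repeats self         w∈ (w∉ ∷ _) = All.lookup w∉ w∈ refl
  reverse-onto-repeats (down _ _ b) w∈          = reverse-onto-repeats b (there w∈)

  module Forest (acyclic : Acyclic G) where

    revisit⇒cycle : NonBacktracking (x ∷ pre ++ x ∷ post) → Unique (pre ++ x ∷ post) →
                    IsCycle G (x ∷ pre)
    revisit⇒cycle {pre = []}        (edge a)       _ = ⊥-elim (Adj-irrefl a)
    revisit⇒cycle {pre = []}        (turn a _ _)   _ = ⊥-elim (Adj-irrefl a)
    revisit⇒cycle {pre = _ ∷ []}    (turn _ x≢x _) _ = ⊥-elim (x≢x refl)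
    revisit⇒cycle {pre = pre@(_ ∷ _ ∷ _)} nb u =
      s≤s (s≤s z≤n) ,
      Allₚ.¬Any⇒All¬ pre (λ x∈pre → Unique-++⇒Disjoint pre u (x∈pre , here refl))
        ∷ Unique-++⁻ˡ pre u ,
      Chain-split (NonBacktracking⇒Chain nb)

    nonBacktracking-head∉ : NonBacktracking (x ∷ xs) → Unique xs → x ∉ xs
    nonBacktracking-head∉ nb u x∈xs with pre , post , refl ← ∈-∃++ x∈xs =
      acyclic _ (revisit⇒cycle nb u)

    nonBacktracking⇒Unique : NonBacktracking xs → Unique xs
    nonBacktracking⇒Unique [ _ ] = [] ∷ []
    nonBacktracking⇒Unique nb@(edge _) =
      Allₚ.¬Any⇒All¬ _ (nonBacktracking-head∉ nb ([] ∷ [])) ∷ [] ∷ []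
    nonBacktracking⇒Unique nb@(turn _ _ nb′) =
      Allₚ.¬Any⇒All¬ _ (nonBacktracking-head∉ nb tail!) ∷ tail!
      where tail! = nonBacktracking⇒Unique nb′

    -- Walking up b₂ from w to v and then down b₁ back to w would be a
    -- non-backtracking walk revisiting w.
    Branch-sides-disjoint : Adj G v c → Branch v c w → ¬ Branch c v w
    Branch-sides-disjoint a b₁ b₂ =
      reverse-onto-repeats b₂ (Branch-end∈ b₁)
        (nonBacktracking⇒Unique (reverse-onto-nonBacktracking b₂ (Branch-nonBacktracking a b₁)))

    Branch-no-return : Adj G p v → ¬ Branch p v p
    Branch-no-return a b = Branch-sides-disjoint a b self

    Branch-siblings-disjoint : Adj G v c → Adj G v d → c ≢ d → Branch v c w → ¬ Branch v d w
    Branch-siblings-disjoint a a′ c≢d b b′ = Branch-sides-disjoint a b (down a′ (c≢d ∘ ≡.sym) b′)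

    Branch-steps-bounded : Adj G p v → (b : Branch p v w) → length (steps b) < n G
    Branch-steps-bounded a b = <⇒≤ (Unique⇒length≤ (nonBacktracking⇒Unique (Branch-nonBacktracking a b)))

module PathCovers (G : Graph) (acyclic : Acyclic G) (k : ℕ) (spread : LeafDistancesAtLeast G k) where

  open Walks G using (Adj-sym; Chain-tail; Chain⇒Walk; _++ʷ_; reverseʷ; spread≤walk)
  open Leaves G using (only-neighbour⇒leaf)
  open Branches G
  open Branches.Forest G acyclic

  private variable
    c p u v w : Vertex G
    S S₁ S₂ S′ : Vertex G → Set

  Long : List (Vertex G) → Set
  Long q = k ≤ 2 * length q

  -- The closed paths are final; the open path start ∷ rest may still be
  -- extended upwards through v.
  record Cover (v : Vertex G) (S : Vertex G → Set) : Set where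
    field
      start        : Vertex G
      rest         : List (Vertex G)
      closed       : List (List (Vertex G))
      attached     : Chain G (v ∷ start ∷ rest)
      leaf-end     : IsLeaf G (last' start rest)
      closed-paths : All (IsPath G) closed
      closed-long  : All Long closed
      distinct     : Unique (concat ((start ∷ rest) ∷ closed))
      sound        : ∀ {w} → w ∈ concat ((start ∷ rest) ∷ closed) → S w
      complete     : ∀ {w} → S w → w ∈ concat ((start ∷ rest) ∷ closed)

    hanging : List (Vertex G)
    hanging = start ∷ rest

    vertices : List (Vertex G)
    vertices = concat (hanging ∷ closed)

    hanging-path : IsPath G hanging
    hanging-path = (λ ()) , Unique-++⁻ˡ hanging distinct , Chain-tail attached

    leaf∈S : S (last' start rest)
    leaf∈S = sound (∈-++⁺ˡ (last'∈ start rest))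

    leaf-walk : Walk G v (last' start rest) (length hanging)
    leaf-walk = Chain⇒Walk attached

  Cover-resp : (∀ {w} → S w → S′ w) → (∀ {w} → S′ w → S w) → Cover v S → Cover v S′
  Cover-resp to from C = record
    { Cover C using (start; rest; closed; attached; leaf-end; closed-paths; closed-long; distinct)
    ; sound    = λ w∈ → to (Cover.sound C w∈)
    ; complete = λ s → Cover.complete C (from s) }

  merge : (C₁ : Cover v S₁) (C₂ : Cover v S₂) → (∀ {w} → S₁ w → ¬ S₂ w) →
          Long (Cover.hanging C₂) → Cover v (λ w → S₁ w ⊎ S₂ w)
  merge C₁ C₂ apart long = record
    { start        = C₁.start
    ; rest         = C₁.rest
    ; closed       = C₁.closed ++ C₂.hanging ∷ C₂.closed
    ; attached     = C₁.attached
    ; leaf-end     = C₁.leaf-end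
    ; closed-paths = Allₚ.++⁺ C₁.closed-paths (C₂.hanging-path ∷ C₂.closed-paths)
    ; closed-long  = Allₚ.++⁺ C₁.closed-long (long ∷ C₂.closed-long)
    ; distinct     = subst Unique (≡.sym split)
                       (++⁺ C₁.distinct C₂.distinct λ (w∈₁ , w∈₂) →
                          apart (C₁.sound w∈₁) (C₂.sound w∈₂))
    ; sound        = λ {w} w∈ →
                       Sum.map C₁.sound C₂.sound (∈-++⁻ C₁.vertices (subst (w ∈_) split w∈))
    ; complete     = λ {w} s → subst (w ∈_) (≡.sym split)
                       (Sum.[ ∈-++⁺ˡ , ∈-++⁺ʳ C₁.vertices ]′ (Sum.map C₁.complete C₂.complete s)) }
    where
    module C₁ = Cover C₁
    module C₂ = Cover C₂
    split : concat (C₁.hanging ∷ C₁.closed ++ C₂.hanging ∷ C₂.closed) ≡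
            C₁.vertices ++ C₂.vertices
    split = concat-∷-++ C₁.hanging C₁.closed (C₂.hanging ∷ C₂.closed)

  combine : Cover v S₁ → Cover v S₂ → (∀ {w} → S₁ w → ¬ S₂ w) → Cover v (λ w → S₁ w ⊎ S₂ w)
  combine {v = v} {S₁ = S₁} {S₂ = S₂} C₁ C₂ apart =
    keep-shorter (length C₁.hanging ≤? length C₂.hanging)
    where
    module C₁ = Cover C₁
    module C₂ = Cover C₂
    k≤ : k ≤ length C₁.hanging + length C₂.hanging
    k≤ = spread≤walk spread C₁.leaf-end C₂.leaf-end
           (λ e → apart C₁.leaf∈S (subst S₂ (≡.sym e) C₂.leaf∈S))
           (reverseʷ C₁.leaf-walk ++ʷ C₂.leaf-walk)
    keep-shorter : Dec (length C₁.hanging ≤ length C₂.hanging) → Cover v (λ w → S₁ w ⊎ S₂ w)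
    keep-shorter (yes ≤) = merge C₁ C₂ apart (≤-sum⇒≤-double k≤ ≤)
    keep-shorter (no ≰)  = Cover-resp swap swap
      (merge C₂ C₁ (λ s₂ s₁ → apart s₁ s₂)
             (≤-sum⇒≤-double (subst (k ≤_) (+-comm (length C₁.hanging) _) k≤) (≰⇒≥ ≰)))

  branches-cover : ∀ d ds → Unique (d ∷ ds) → (∀ {c} → c ∈ d ∷ ds → Adj G v c) →
                   (∀ {c} → c ∈ d ∷ ds → Cover v (Branch v c)) →
                   Cover v (λ w → Any (λ c → Branch v c w) (d ∷ ds))
  branches-cover d [] _ _ sub = Cover-resp here (λ { (here b) → b ; (there ()) }) (sub (here refl))
  branches-cover {v = v} d (d′ ∷ ds) (d∉ds ∷ ds!) adj sub = Cover-resp fromSum toSum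
    (combine (sub (here refl)) (branches-cover d′ ds ds! (adj ∘ there) (sub ∘ there)) apart)
    where
    apart : Branch v d w → ¬ Any (λ c → Branch v c w) (d′ ∷ ds)
    apart b any = let c , c∈ , b′ = find any in
      Branch-siblings-disjoint (adj (here refl)) (adj (there c∈)) (All.lookup d∉ds c∈) b b′

  graft : Adj G p v → Cover v (Below p v) → Cover p (Branch p v)
  graft {p = p} {v = v} a C = record
    { start        = v
    ; rest         = C.hanging
    ; closed       = C.closed
    ; attached     = a ∷ C.attached
    ; leaf-end     = C.leaf-end
    ; closed-paths = C.closed-paths
    ; closed-long  = C.closed-long
    ; distinct     = Allₚ.¬Any⇒All¬ _ (v∉Below ∘ C.sound) ∷ C.distinct
    ; sound        = λ { (here refl) → self
                       ; (there w∈)  → let _ , (a′ , c≢p) , b = C.sound w∈ in down a′ c≢p b }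
    ; complete     = λ { self            → here refl
                       ; (down a′ c≢p b) → there (C.complete (_ , (a′ , c≢p) , b)) } }
    where
    module C = Cover C
    v∉Below : ¬ Below p v v
    v∉Below (_ , (a′ , _) , b) = Branch-no-return a′ b

  leaf-cover : Adj G p v → (∀ {c} → ¬ Child p v c) → Cover p (Branch p v)
  leaf-cover {p = p} {v = v} a childless = record
    { start        = v
    ; rest         = []
    ; closed       = []
    ; attached     = a ∷ [ v ]
    ; leaf-end     = only-neighbour⇒leaf (Adj-sym a) only-p
    ; closed-paths = []
    ; closed-long  = []
    ; distinct     = [] ∷ []
    ; sound        = λ { (here refl) → self ; (there ()) }
    ; complete     = λ { self → here refl ; (down a′ c≢p _) → ⊥-elim (childless (a′ , c≢p)) } }
    where
    only-p : Adj G v u → u ≡ p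
    only-p {u = u} a′ = decidable-stable (u ≟ p) (λ u≢p → childless (a′ , u≢p))

  bounded-branch-cover : ∀ fuel → Adj G p v → (∀ {w} (b : Branch p v w) → length (steps b) < fuel) →
                         Cover p (Branch p v)
  bounded-branch-cover zero _ bounded = contradiction (bounded self) λ ()
  bounded-branch-cover {p = p} {v = v} (suc fuel) a bounded =
    from-children (children p v) children-unique ∈-children⁻ ∈-children⁺
    where
    sub : Child p v c → Cover v (Branch v c)
    sub (a′ , c≢p) = bounded-branch-cover fuel a′ (λ b → ≤-pred (bounded (down a′ c≢p b)))
    from-children : ∀ ds → Unique ds →
                    (∀ {c} → c ∈ ds → Child p v c) → (∀ {c} → Child p v c → c ∈ ds) →
                    Cover p (Branch p v)
    from-children []       _   _     complete = leaf-cover a λ child → contradiction (complete child) λ ()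
    from-children (d ∷ ds) ds! sound complete = graft a (Cover-resp
      (λ any → let c , c∈ , b = find any in c , sound c∈ , b)
      (λ (c , child , b) → lose (complete child) b)
      (branches-cover d ds ds! (proj₁ ∘ sound) (sub ∘ sound)))

  branch-cover : Adj G p v → Cover p (Branch p v)
  branch-cover a = bounded-branch-cover (n G) a (Branch-steps-bounded a)

  close-at-leaf : IsLeaf G p → ¬ S p → (∀ w → w ≡ p ⊎ S w) → Cover p S →
                  Σ[ ps ∈ List (List (Vertex G)) ] IsPathPartition G ps × All Long ps
  close-at-leaf {p = p} {S = S} p-leaf p∉S total C =
    (p ∷ C.hanging) ∷ C.closed , (path ∷ C.closed-paths , permutation) , long ∷ C.closed-long
    where
    module C = Cover C
    distinct : Unique (p ∷ C.vertices)
    distinct = Allₚ.¬Any⇒All¬ _ (p∉S ∘ C.sound) ∷ C.distinct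
    path : IsPath G (p ∷ C.hanging)
    path = (λ ()) , Unique-++⁻ˡ (p ∷ C.hanging) distinct , C.attached
    permutation : p ∷ C.vertices ↭ allFin (n G)
    permutation = ∼bag⇒↭ (unique∧set⇒bag distinct (allFin⁺ (n G)) λ {w} →
      mk⇔ (λ _ → ∈-allFin w) (λ _ → Sum.[ (λ { refl → here refl }) , there ]′ (Sum.map₂ C.complete (total w))))
    p≢leaf : p ≢ last' C.start C.rest
    p≢leaf p≡leaf = p∉S (subst S (≡.sym p≡leaf) C.leaf∈S)
    long : Long (p ∷ C.hanging)
    long = ≤-trans (spread≤walk spread p-leaf C.leaf-end p≢leaf C.leaf-walk) (≤-trans (n≤1+n _) (m≤m+n _ _))

lemma3p7 : (G : Graph) (k : ℕ) → IsTree G → HasSpread G k →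
    Σ (List (List (Fin (n G)))) λ ps →
    IsPathPartition G ps × All (λ p → k ≤ 2 * length p) ps
lemma3p7 G k (connected , acyclic) ((r , _ , r-leaf , _) , spread) =
  let v , r-adj , only-v = leaf⇒only-neighbour r-leaf
  in close-at-leaf r-leaf (Branch-no-return r-adj) (Branch-covers-all connected only-v)
                   (branch-cover r-adj)
  where
  open Leaves G
  open Branches G
  open Branches.Forest G acyclic
  open PathCovers G acyclic k spread
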